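{- Let $u$ and $v$ be integers such that $u^2+v^2$ is a positive multiple of $5$. Then $u^2+v^2=x^2+y^2$ for some integers $x,y$ with $5\nmid xy$. -}

module Defs where

-- Think of u + iv as a Gaussian integer of norm N = u² + v².  The number
-- x + iy is "primitive" when 5 ∤ 2x − y, i.e. when it is not divisible by
-- the Gaussian prime 2 + i (indeed (2 + i)(k + iz) = 2k − z + i(k + 2z), and
-- 2(2k − z) − (k + 2z) = 5(k − z)).  The proof has three parts.
--   * Descent: if u + iv is not primitive, then 2u − v = 5k and
--     u² + v² = 5 (k² + (u − 2k)²), so u + iv = (2 + i)(k + i(u − 2k)) has a
--     cofactor of strictly smaller positive norm.  Recursing on it and
--     multiplying back by 2 + i (which maps primitive numbers to primitive
--     numbers, since 2(2x − y) − (x + 2y) ≡ 4(2x − y) mod 5) yields a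
--     primitive representation of every positive norm.
--   * If x + iy is primitive and 5 ∣ x² + y², then 5 ∤ xy: otherwise 5 divides
--     x or y, hence (since 5 ∣ x² + y² and 5 is prime) both, hence 2x − y.
--   * The theorem combines the two.
module Submission where

open import Defs
open import Data.Integer using (ℤ; +_; _+_; _*_; _<_)
open import Data.Integer.Divisibility using (_∣_)
open import Data.Product using (Σ; _×_)
open import Relation.Nullary using (¬_)
open import Relation.Binary.PropositionalEquality using (_≡_)

open import Data.Integer using (_-_; ∣_∣; +[1+_]; -[1+_]; +<+)
import Data.Integer.Properties as ℤ
import Data.Integer.Divisibility.Signed as Signed
open Signed using (divides; _∣?_)
import Data.Nat as ℕ
import Data.Nat.Properties as ℕ
import Data.Nat.Divisibility as ℕ
open import Data.Nat.Primality using (Prime; prime?; euclidsLemma)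
open import Data.Product using (_,_)
open import Data.Sum using (_⊎_; inj₁; inj₂)
open import Induction.WellFounded using (Acc; acc)
open import Data.Nat.Induction using (<-wellFounded)
open import Relation.Nullary using (yes; no)
open import Relation.Nullary.Decidable using (toWitness)
open import Relation.Binary.PropositionalEquality using (refl; trans; cong; subst; module ≡-Reasoning)
open import Data.Integer.Solver using (module +-*-Solver)
open +-*-Solver using (solve; _:=_; _:+_; _:-_; _:*_; con)

prime-∣-* : ∀ {p} → Prime p → ∀ a b → + p Signed.∣ a * b → + p Signed.∣ a ⊎ + p Signed.∣ b
prime-∣-* {p} p-prime a b p∣ab
  with euclidsLemma ∣ a ∣ ∣ b ∣ p-prime (subst (p ℕ.∣_) (ℤ.abs-* a b) (Signed.∣⇒∣ᵤ p∣ab))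
... | inj₁ p∣a = inj₁ (Signed.∣ᵤ⇒∣ p∣a)
... | inj₂ p∣b = inj₂ (Signed.∣ᵤ⇒∣ p∣b)

prime-∣-square : ∀ {p} → Prime p → ∀ a → + p Signed.∣ a * a → + p Signed.∣ a
prime-∣-square p-prime a p∣aa with prime-∣-* p-prime a a p∣aa
... | inj₁ p∣a = p∣a
... | inj₂ p∣a = p∣a

prime-5 : Prime 5
prime-5 = toWitness {a? = prime? 5} _

norm : ℤ → ℤ → ℤ
norm x y = x * x + y * y

Primitive : ℤ → ℤ → Set
Primitive x y = ¬ (+ 5 Signed.∣ + 2 * x - y)

PrimitiveRep : ℤ → ℤ → Set
PrimitiveRep u v = Σ ℤ (λ x → Σ ℤ (λ y → (norm u v ≡ norm x y) × Primitive x y))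

norm-times-2+i : ∀ x y → + 5 * norm x y ≡ norm (+ 2 * x - y) (x + + 2 * y)
norm-times-2+i = solve 2 (λ x y →
  con (+ 5) :* (x :* x :+ y :* y)
    := (con (+ 2) :* x :- y) :* (con (+ 2) :* x :- y) :+ (x :+ con (+ 2) :* y) :* (x :+ con (+ 2) :* y))
  refl

-- Multiplying by 2 + i preserves primitivity, because
-- 2(2x − y) − (x + 2y) + 5x = 4(2x − y) and 4 is invertible mod 5.
times-2+i-primitive : ∀ x y → Primitive x y → Primitive (+ 2 * x - y) (x + + 2 * y)
times-2+i-primitive x y prim 5∣new = prim 5∣old
  where
  w : ℤ
  w = + 2 * x - y
  5∣4w : + 5 Signed.∣ + 4 * w
  5∣4w = subst (+ 5 Signed.∣_)
    (solve 2 (λ x y → (con (+ 2) :* (con (+ 2) :* x :- y) :- (x :+ con (+ 2) :* y)) :+ con (+ 5) :* x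
                        := con (+ 4) :* (con (+ 2) :* x :- y)) refl x y)
    (Signed.∣m∣n⇒∣m+n 5∣new (Signed.∣m⇒∣m*n x (Signed.∣-refl {+ 5})))
  5∣old : + 5 Signed.∣ w
  5∣old = subst (+ 5 Signed.∣_) (solve 1 (λ t → con (+ 5) :* t :- con (+ 4) :* t := t) refl w)
    (Signed.∣m∣n⇒∣m-n (Signed.∣m⇒∣m*n w (Signed.∣-refl {+ 5})) 5∣4w)

-- Descent step: if 2u − v = 5k then u + iv = (2 + i)(k + i(u − 2k)).
norm-descent : ∀ u v k → + 2 * u - v ≡ k * + 5 → norm u v ≡ + 5 * norm k (u - + 2 * k)
norm-descent u v k eq = begin
  u * u + v * v
    ≡⟨ cong (λ t → u * u + t * t) v≡2u-5k ⟩
  u * u + (+ 2 * u - k * + 5) * (+ 2 * u - k * + 5)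
    ≡⟨ solve 2 (λ u k → u :* u :+ (con (+ 2) :* u :- k :* con (+ 5)) :* (con (+ 2) :* u :- k :* con (+ 5))
                  := con (+ 5) :* (k :* k :+ (u :- con (+ 2) :* k) :* (u :- con (+ 2) :* k))) refl u k ⟩
  + 5 * (k * k + (u - + 2 * k) * (u - + 2 * k)) ∎
  where
  open ≡-Reasoning
  v≡2u-5k : v ≡ + 2 * u - k * + 5
  v≡2u-5k = trans (solve 2 (λ u v → v := con (+ 2) :* u :- (con (+ 2) :* u :- v)) refl u v)
                  (cong (λ t → + 2 * u - t) eq)

positive-cofactor : ∀ {N} m → N ≡ + 5 * m → + 0 < N → (+ 0 < m) × (∣ m ∣ ℕ.< ∣ N ∣)
positive-cofactor +[1+ n ] refl _ = +<+ ℕ.z<s , ℕ.m<m+n (ℕ.suc n) ℕ.z<s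
positive-cofactor (+ 0)    refl (+<+ ())
positive-cofactor -[1+ n ] refl ()

primitive-rep : ∀ u v → + 0 < norm u v → Acc ℕ._<_ ∣ norm u v ∣ → PrimitiveRep u v
primitive-rep u v pos (acc smaller) with + 5 ∣? (+ 2 * u - v)
... | no prim = u , v , refl , prim
... | yes (divides k eq) with norm-descent u v k eq
... | N≡5M with positive-cofactor (norm k (u - + 2 * k)) N≡5M pos
... | M-pos , M<N with primitive-rep k (u - + 2 * k) M-pos (smaller M<N)
... | x , y , M≡ , prim =
  + 2 * x - y , x + + 2 * y ,
  trans N≡5M (trans (cong (+ 5 *_) M≡) (norm-times-2+i x y)) ,
  times-2+i-primitive x y prim

primitive-coprime-product : ∀ x y → Primitive x y → + 5 Signed.∣ norm x y → ¬ (+ 5 Signed.∣ x * y)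
primitive-coprime-product x y prim 5∣N 5∣xy with prime-∣-* prime-5 x y 5∣xy
... | inj₁ 5∣x = prim (Signed.∣m∣n⇒∣m-n (Signed.∣n⇒∣m*n (+ 2) 5∣x)
                  (prime-∣-square prime-5 y (Signed.∣m+n∣m⇒∣n 5∣N (Signed.∣m⇒∣m*n x 5∣x))))
... | inj₂ 5∣y = prim (Signed.∣m∣n⇒∣m-n (Signed.∣n⇒∣m*n (+ 2)
                  (prime-∣-square prime-5 x (Signed.∣m+n∣n⇒∣m 5∣N (Signed.∣m⇒∣m*n y 5∣y)))) 5∣y)

lemma2p1 : (u v : ℤ) → + 0 < u * u + v * v → + 5 ∣ u * u + v * v →
    Σ ℤ (λ x → Σ ℤ (λ y → (u * u + v * v ≡ x * x + y * y) × ¬ (+ 5 ∣ x * y)))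
lemma2p1 u v pos 5∣N with primitive-rep u v pos (<-wellFounded _)
... | x , y , N≡ , prim =
  x , y , N≡ ,
  λ 5∣xy → primitive-coprime-product x y prim
             (subst (+ 5 Signed.∣_) N≡ (Signed.∣ᵤ⇒∣ 5∣N)) (Signed.∣ᵤ⇒∣ 5∣xy)
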